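{- For every $n\ge1$, $$I(n):=(n-1)!+n-1\;\le\; m(n)\;\le\; S(n):=(n-1)(n-1)!+1,$$ and $\dfrac{S(n)}{I(n)}\sim n$ as $n\to\infty$.
   Context: Let $[n]=\{1,\dots,n\}$ and identify $\pi\in S_n$ with its one-line word $\pi(1)\cdots\pi(n)$. Let $\sigma\in S_n$ be $\sigma(i)=i+1$ for $i<n$, $\sigma(n)=1$ (values modulo $n$ in $[n]$). For $\pi\in S_n$ let $\mathrm{inc}(\pi)=\{\sigma^k\circ\pi:0\le k\le n-1\}$; these are the classes of an equivalence relation $\mathcal{R}_2$ on $S_n$. A word $u$ over $[n]$ is universal for $\mathcal{R}_2$ if for every $\pi\in S_n$ some contiguous factor $u(i)\cdots u(i+n-1)$ of $u$ equals the one-line word of some element of $\mathrm{inc}(\pi)$. $m(n)$ is the minimal length of such a word. -}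

module Defs where

open import Data.Nat using (ℕ; zero; suc; _+_; _*_; _∸_; _≤_; _<_; _!; NonZero; ∣_-_∣)
open import Data.Nat.DivMod using (_%_)
open import Data.List using (List; map; length; upTo; _++_)
open import Data.List.Relation.Unary.All using (All)
open import Data.List.Relation.Binary.Permutation.Propositional using (_↭_)
open import Data.Product using (Σ; ∃; _×_; _,_)
open import Relation.Binary.PropositionalEquality using (_≡_)

-- Convention: the alphabet [n] = {1,…,n} is encoded as {0,…,n-1}
-- (letter i+1 of the paper is the number i here).

shift : (n : ℕ) .{{_ : NonZero n}} → ℕ → ℕ → ℕ
shift n k v = (v + k) % n

-- π ∈ S_n as its one-line word: a list that is a permutation of [0,…,n-1]
IsPerm : ℕ → List ℕ → Set
IsPerm n π = π ↭ upTo n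

rot : (n : ℕ) .{{_ : NonZero n}} → ℕ → List ℕ → List ℕ
rot n k π = map (shift n k) π

Factor : List ℕ → List ℕ → Set
Factor w u = Σ (List ℕ) λ xs → Σ (List ℕ) λ ys → u ≡ xs ++ w ++ ys

Universal : (n : ℕ) .{{_ : NonZero n}} → List ℕ → Set
Universal n u =
  All (_< n) u ×
  (∀ π → IsPerm n π → Σ ℕ λ k → k < n × Factor (rot n k π) u)

-- L is m(n), the minimal length of a universal word
IsMinUniversalLength : (n : ℕ) .{{_ : NonZero n}} → ℕ → Set
IsMinUniversalLength n L =
  (Σ (List ℕ) λ u → Universal n u × length u ≡ L) ×
  (∀ u → Universal n u → L ≤ length u)

I : ℕ → ℕ
I n = (n ∸ 1) ! + (n ∸ 1)

S : ℕ → ℕ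
S n = (n ∸ 1) * (n ∸ 1) ! + 1

-- S(n)/I(n) ~ n, i.e. S(n)/(n·I(n)) → 1, written over ℕ:
-- for every k ≥ 1 there is N with |S(n)/(n I(n)) - 1| < 1/k for all n ≥ N.
RatioAsymptoticToN : Set
RatioAsymptoticToN =
  ∀ k → 1 ≤ k → Σ ℕ λ N → ∀ n → N ≤ n →
    k * ∣ S n - n * I n ∣ < n * I n

-- Every class inc(π) contains exactly one word beginning with the letter 0, namely
-- 0 ∷ p with p a permutation of 1…n−1, and its element k ∷ (p shifted by k) reveals
-- both k (its first letter) and p; so a window of length n of a word determines the
-- class it represents. Chaining the (n−1)! representatives, each shifted to start
-- with the last letter of the previous block, gives a universal word of length
-- 1 + (n−1)·(n−1)! = S(n). Conversely the (n−1)! classes inc(0 ∷ p) need pairwise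
-- distinct starting positions i with i + n ≤ |u|, whence |u| ≥ (n−1)! + n − 1 = I(n).
-- Universality of a word and the existence of a universal word of given length are
-- decidable, so the least length exists. Finally n·I(n) − S(n) = (n−1)! + O(n²) is at
-- most 3·(n−1)! for n ≥ 4, so S(n)/I(n) ∼ n.

module Submission where

open import Defs
open import Data.Nat using (ℕ; zero; suc; _+_; _*_; _∸_; _≤_; _<_; _!; z≤n; s≤s; z<s; NonZero; ∣_-_∣)
open import Data.Nat.Properties
open import Data.Nat.DivMod using (_%_; m%n<n; m%n%n≡m%n; %-distribˡ-+; m<n⇒m%n≡m; n%n≡0; [m+n]%n≡m%n)
open import Data.Nat.Induction using (<-rec)
open import Data.Nat.Solver using (module +-*-Solver)
open import Data.Fin using (Fin; zero; suc; fromℕ<)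
open import Data.Fin.Properties using (injective⇒≤; fromℕ<-injective)
open import Data.List using (List; []; _∷_; _++_; _∷ʳ_; map; concatMap; length; lookup; take; drop; applyUpTo; upTo)
open import Data.List.Properties
  using (∷-injectiveˡ; ∷-injectiveʳ; length-++; length-map; length-applyUpTo; ++-assoc; map-∘; map-cong;
         map-id-local; map-cong-local; map-++; map-applyUpTo; upTo-∷ʳ)
open import Data.List.Membership.Propositional using (_∈_; _∉_; find; lose)
open import Data.List.Membership.Propositional.Properties
  using (∈-map⁺; ∈-map⁻; ∈-concatMap⁺; ∈-concatMap⁻; ∈-∃++; ∈-lookup; ∈-++⁺ˡ; ∈-upTo⁻)
open import Data.List.Relation.Unary.Any using (here; there)
open import Data.List.Relation.Unary.All as All using (All; []; _∷_)
import Data.List.Relation.Unary.All.Properties as All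
open import Data.List.Relation.Unary.AllPairs using ([]; _∷_)
open import Data.List.Relation.Unary.Unique.Propositional using (Unique)
import Data.List.Relation.Unary.Unique.Propositional.Properties as Unique
open import Data.List.Relation.Binary.Disjoint.Propositional using (Disjoint)
open import Data.List.Relation.Binary.Pointwise using (Pointwise-≡⇒≡; ≡⇒Pointwise-≡)
open import Data.List.Relation.Binary.Infix.Heterogeneous using (Infix; toView; fromView; MkView)
open import Data.List.Relation.Binary.Infix.Heterogeneous.Properties using (infix?)
open import Data.List.Relation.Binary.Permutation.Propositional
  using (_↭_; ↭-refl; ↭-sym; ↭-trans; ↭-reflexive; prep; module PermutationReasoning)
open import Data.List.Relation.Binary.Permutation.Propositional.Properties
  using (↭-length; ↭-empty-inv; ∈-resp-↭; All-resp-↭; drop-mid; drop-∷; map⁺; ∷↭∷ʳ) renaming (shift to ↭-shift)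
open import Data.Product using (Σ; ∃; ∃₂; _×_; _,_; proj₁; proj₂)
open import Function using (_∘_; id)
open import Relation.Nullary using (Dec; yes; no; contradiction)
open import Relation.Nullary.Decidable using (map′; _×-dec_)
open import Relation.Unary using (Pred; Decidable)
open import Relation.Binary.PropositionalEquality
  using (_≡_; _≢_; refl; sym; trans; cong; cong₂; subst; module ≡-Reasoning)

module _ {A B : Set} where

  length-concatMap-const : (f : A → List B) {c : ℕ} (xs : List A) →
    (∀ {x} → x ∈ xs → length (f x) ≡ c) → length (concatMap f xs) ≡ length xs * c
  length-concatMap-const f []       _   = refl
  length-concatMap-const f (x ∷ xs) len =
    trans (length-++ (f x)) (cong₂ _+_ (len (here refl)) (length-concatMap-const f xs (len ∘ there)))

  concatMap-unique : {f : A → List B} {xs : List A} → Unique xs →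
    (∀ {x} → x ∈ xs → Unique (f x)) →
    (∀ {x y v} → x ∈ xs → y ∈ xs → v ∈ f x → v ∈ f y → x ≡ y) →
    Unique (concatMap f xs)
  concatMap-unique {f} {[]}     []         _   _    = []
  concatMap-unique {f} {x ∷ xs} (x∉ ∷ xs!) f! same =
    Unique.++⁺ (f! (here refl)) (concatMap-unique xs! (f! ∘ there) (λ x∈ y∈ → same (there x∈) (there y∈)))
      disjoint
    where
    disjoint : Disjoint (f x) (concatMap f xs)
    disjoint (v∈fx , v∈rest) with find (∈-concatMap⁻ f v∈rest)
    ... | y , y∈ , v∈fy = All.lookup x∉ y∈ (same (here refl) (there y∈) v∈fx v∈fy)

module _ {A : Set} where

  unique-lookup-injective : {xs : List A} → Unique xs →
    ∀ {i j} → lookup xs i ≡ lookup xs j → i ≡ j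
  unique-lookup-injective (_  ∷ _)  {zero}  {zero}  _  = refl
  unique-lookup-injective (x∉ ∷ _)  {zero}  {suc j} eq = contradiction eq (All.lookup x∉ (∈-lookup j))
  unique-lookup-injective (x∉ ∷ _)  {suc i} {zero}  eq = contradiction (sym eq) (All.lookup x∉ (∈-lookup i))
  unique-lookup-injective (_  ∷ xs!) {suc i} {suc j} eq = cong suc (unique-lookup-injective xs! eq)

  unique-length-≤ : {xs : List A} {m : ℕ} → Unique xs → (f : ∀ {x} → x ∈ xs → Fin m) →
    (∀ {x y} (x∈ : x ∈ xs) (y∈ : y ∈ xs) → f x∈ ≡ f y∈ → x ≡ y) → length xs ≤ m
  unique-length-≤ xs! f f-inj =
    injective⇒≤ (λ eq → unique-lookup-injective xs! (f-inj (∈-lookup _) (∈-lookup _) eq))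

  ++-∷-injective : ∀ {x : A} {l l′ r r′} → x ∉ l → x ∉ l′ →
    l ++ x ∷ r ≡ l′ ++ x ∷ r′ → l ≡ l′ × r ≡ r′
  ++-∷-injective {l = []}    {[]}     _    _     eq = refl , ∷-injectiveʳ eq
  ++-∷-injective {l = []}    {y ∷ l′} _    x∉l′  eq = contradiction (here (∷-injectiveˡ eq)) x∉l′
  ++-∷-injective {l = y ∷ l} {[]}     x∉l  _     eq = contradiction (here (sym (∷-injectiveˡ eq))) x∉l
  ++-∷-injective {l = y ∷ l} {y′ ∷ l′} x∉l x∉l′ eq
    with refl ← ∷-injectiveˡ eq
    with refl , refl ← ++-∷-injective (x∉l ∘ there) (x∉l′ ∘ there) (∷-injectiveʳ eq) = refl , refl

  take-length-++ : (w ys : List A) → take (length w) (w ++ ys) ≡ w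
  take-length-++ []      ys = refl
  take-length-++ (x ∷ w) ys = cong (x ∷_) (take-length-++ w ys)

  take-drop-++ : (xs w ys : List A) → take (length w) (drop (length xs) (xs ++ w ++ ys)) ≡ w
  take-drop-++ []       = take-length-++
  take-drop-++ (_ ∷ xs) = take-drop-++ xs

  lastOf : A → List A → A
  lastOf x []       = x
  lastOf _ (y ∷ ys) = lastOf y ys

  lastOf-split : ∀ x ys → ∃ λ init → x ∷ ys ≡ init ∷ʳ lastOf x ys
  lastOf-split x []       = [] , refl
  lastOf-split x (y ∷ ys) with init , eq ← lastOf-split y ys = x ∷ init , cong (x ∷_) eq

  All-lastOf : ∀ {P : A → Set} {x ys} → All P (x ∷ ys) → P (lastOf x ys)
  All-lastOf (px ∷ [])  = px
  All-lastOf (_ ∷ pys@(_ ∷ _)) = All-lastOf pys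

module _ {A : Set} where

  insertions : A → List A → List (List A)
  insertions x []       = (x ∷ []) ∷ []
  insertions x (y ∷ ys) = (x ∷ y ∷ ys) ∷ map (y ∷_) (insertions x ys)

  permutations : List A → List (List A)
  permutations []       = [] ∷ []
  permutations (x ∷ xs) = concatMap (insertions x) (permutations xs)

  ∈-insertions⁺ : ∀ x l r → l ++ x ∷ r ∈ insertions x (l ++ r)
  ∈-insertions⁺ x []      []      = here refl
  ∈-insertions⁺ x []      (y ∷ r) = here refl
  ∈-insertions⁺ x (y ∷ l) r       = there (∈-map⁺ (y ∷_) (∈-insertions⁺ x l r))

  ∈-insertions⁻ : ∀ {x ys p} → p ∈ insertions x ys → ∃₂ λ l r → ys ≡ l ++ r × p ≡ l ++ x ∷ r
  ∈-insertions⁻ {ys = []}     (here refl) = [] , [] , refl , refl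
  ∈-insertions⁻ {ys = y ∷ ys} (here refl) = [] , y ∷ ys , refl , refl
  ∈-insertions⁻ {ys = y ∷ ys} (there p∈)
    with q , q∈ , refl ← ∈-map⁻ (y ∷_) p∈
    with l , r , refl , refl ← ∈-insertions⁻ q∈ = y ∷ l , r , refl , refl

  insertions-↭ : ∀ {x ys p} → p ∈ insertions x ys → p ↭ x ∷ ys
  insertions-↭ p∈ with l , r , refl , refl ← ∈-insertions⁻ p∈ = ↭-shift _ l r

  length-insertions : ∀ x ys → length (insertions x ys) ≡ suc (length ys)
  length-insertions x []       = refl
  length-insertions x (y ∷ ys) = cong suc (trans (length-map (y ∷_) (insertions x ys)) (length-insertions x ys))

  permutations-↭ : ∀ xs {p} → p ∈ permutations xs → p ↭ xs
  permutations-↭ []       (here refl) = ↭-refl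
  permutations-↭ (x ∷ xs) p∈ with q , q∈ , p∈′ ← find (∈-concatMap⁻ (insertions x) p∈) =
    ↭-trans (insertions-↭ p∈′) (prep x (permutations-↭ xs q∈))

  ↭⇒∈-permutations : ∀ xs {p} → p ↭ xs → p ∈ permutations xs
  ↭⇒∈-permutations []       p↭ rewrite ↭-empty-inv p↭ = here refl
  ↭⇒∈-permutations (x ∷ xs) p↭ with l , r , refl ← ∈-∃++ (∈-resp-↭ (↭-sym p↭) (here refl)) =
    ∈-concatMap⁺ (insertions x) (lose (↭⇒∈-permutations xs (drop-mid l [] p↭)) (∈-insertions⁺ x l r))

  length-permutations : ∀ xs → length (permutations xs) ≡ length xs !
  length-permutations []       = refl
  length-permutations (x ∷ xs) = begin
    length (concatMap (insertions x) (permutations xs)) ≡⟨ length-concatMap-const (insertions x) _ len ⟩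
    length (permutations xs) * suc (length xs)          ≡⟨ cong (_* suc (length xs)) (length-permutations xs) ⟩
    length xs ! * suc (length xs)                       ≡⟨ *-comm (length xs !) _ ⟩
    suc (length xs) !                                   ∎
    where
    open ≡-Reasoning
    len : ∀ {q} → q ∈ permutations xs → length (insertions x q) ≡ suc (length xs)
    len {q} q∈ = trans (length-insertions x q) (cong suc (↭-length (permutations-↭ xs q∈)))

  insertions-unique : ∀ {x ys} → x ∉ ys → Unique (insertions x ys)
  insertions-unique {ys = []}     _   = [] ∷ []
  insertions-unique {x} {y ∷ ys} x∉ =
    All.map⁺ (All.universal {P = λ q → x ∷ y ∷ ys ≢ y ∷ q} (λ _ eq → x∉ (here (∷-injectiveˡ eq))) _)
      ∷ Unique.map⁺ ∷-injectiveʳ (insertions-unique (x∉ ∘ there))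

  insertions-disjoint : ∀ {x q q′ p} → x ∉ q → x ∉ q′ →
    p ∈ insertions x q → p ∈ insertions x q′ → q ≡ q′
  insertions-disjoint x∉q x∉q′ p∈ p∈′
    with l , r , refl , refl ← ∈-insertions⁻ p∈
    with l′ , r′ , refl , eq ← ∈-insertions⁻ p∈′
    with refl , refl ← ++-∷-injective (x∉q ∘ ∈-++⁺ˡ) (x∉q′ ∘ ∈-++⁺ˡ) eq = refl

  permutations-unique : ∀ {xs} → Unique xs → Unique (permutations xs)
  permutations-unique {[]}     _           = [] ∷ []
  permutations-unique {x ∷ xs} (x∉ ∷ xs!) =
    concatMap-unique (permutations-unique xs!) (insertions-unique ∘ x∉perm)
      (λ q∈ q′∈ → insertions-disjoint (x∉perm q∈) (x∉perm q′∈))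
    where
    x∉perm : ∀ {q} → q ∈ permutations xs → x ∉ q
    x∉perm q∈ x∈q = All.lookup x∉ (∈-resp-↭ (permutations-↭ xs q∈) x∈q) refl

factor? : (w u : List ℕ) → Dec (Factor w u)
factor? w u = map′ fromInfix toInfix (infix? _≟_ w u)
  where
  fromInfix : Infix _≡_ w u → Factor w u
  fromInfix i with MkView xs w≋ ys ← toView i = xs , ys , cong (λ v → xs ++ v ++ ys) (sym (Pointwise-≡⇒≡ w≋))
  toInfix : Factor w u → Infix _≡_ w u
  toInfix (xs , ys , refl) = fromView (MkView xs (≡⇒Pointwise-≡ refl) ys)

least-satisfying : ∀ {p} {P : Pred ℕ p} → Decidable P → ∀ {b} → P b → ∃ λ m → P m × (∀ {k} → P k → m ≤ k)
least-satisfying {P = P} P? {b} = <-rec (λ b → P b → ∃ λ m → P m × (∀ {k} → P k → m ≤ k)) step b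
  where
  step : ∀ b → (∀ {k} → k < b → P k → ∃ λ m → P m × (∀ {k} → P k → m ≤ k)) →
         P b → ∃ λ m → P m × (∀ {k} → P k → m ≤ k)
  step b smaller Pb with anyUpTo? P? b
  ... | yes (k , k<b , Pk) = smaller k<b Pk
  ... | no ∄k<b            = b , Pb , λ Pk → ≮⇒≥ (λ k<b → ∄k<b (_ , k<b , Pk))

words? : ∀ {p} {P : Pred (List ℕ) p} → Decidable P → ∀ n ℓ →
  Dec (∃ λ u → All (_< n) u × length u ≡ ℓ × P u)
words? {P = P} P? n zero    = map′ (λ p → [] , [] , refl , p) (λ { ([] , _ , _ , p) → p }) (P? [])
words? {P = P} P? n (suc ℓ) = map′ cons uncons (anyUpTo? (λ a → words? (P? ∘ (a ∷_)) n ℓ) n)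
  where
  cons : (∃ λ a → a < n × ∃ λ u → All (_< n) u × length u ≡ ℓ × P (a ∷ u)) →
         ∃ λ u → All (_< n) u × length u ≡ suc ℓ × P u
  cons (a , a<n , u , u<n , refl , p) = a ∷ u , a<n ∷ u<n , refl , p
  uncons : (∃ λ u → All (_< n) u × length u ≡ suc ℓ × P u) →
           ∃ λ a → a < n × ∃ λ u → All (_< n) u × length u ≡ ℓ × P (a ∷ u)
  uncons (a ∷ u , a<n ∷ u<n , refl , p) = a , a<n , u , u<n , refl , p

module _ {n : ℕ} .{{_ : NonZero n}} where

  +-%-absorbʳ : ∀ m k → (m + k % n) % n ≡ (m + k) % n
  +-%-absorbʳ m k = begin
    (m + k % n) % n         ≡⟨ %-distribˡ-+ m (k % n) n ⟩
    (m % n + k % n % n) % n ≡⟨ cong (λ z → (m % n + z) % n) (m%n%n≡m%n k n) ⟩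
    (m % n + k % n) % n     ≡⟨ %-distribˡ-+ m k n ⟨
    (m + k) % n             ∎
    where open ≡-Reasoning

  shift-< : ∀ k v → shift n k v < n
  shift-< k v = m%n<n (v + k) n

  shift-shift : ∀ j k v → shift n j (shift n k v) ≡ shift n (k + j) v
  shift-shift j k v = begin
    ((v + k) % n + j) % n ≡⟨ cong (_% n) (+-comm ((v + k) % n) j) ⟩
    (j + (v + k) % n) % n ≡⟨ +-%-absorbʳ j (v + k) ⟩
    (j + (v + k)) % n     ≡⟨ cong (_% n) (trans (+-comm j (v + k)) (+-assoc v k j)) ⟩
    (v + (k + j)) % n     ∎
    where open ≡-Reasoning

  shift-% : ∀ k v → shift n (k % n) v ≡ shift n k v
  shift-% k v = +-%-absorbʳ v k

  shift-zero : ∀ {k} → k < n → shift n k 0 ≡ k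
  shift-zero = m<n⇒m%n≡m

  shift-identity : ∀ {v} → v < n → shift n 0 v ≡ v
  shift-identity {v} v<n = trans (cong (_% n) (+-identityʳ v)) (m<n⇒m%n≡m v<n)

  shift-inverse : ∀ {k v} → k ≤ n → v < n → shift n (n ∸ k) (shift n k v) ≡ v
  shift-inverse {k} {v} k≤n v<n = begin
    shift n (n ∸ k) (shift n k v) ≡⟨ shift-shift (n ∸ k) k v ⟩
    (v + (k + (n ∸ k))) % n       ≡⟨ cong (λ z → (v + z) % n) (m+[n∸m]≡n k≤n) ⟩
    (v + n) % n                   ≡⟨ [m+n]%n≡m%n v n ⟩
    v % n                         ≡⟨ m<n⇒m%n≡m v<n ⟩
    v                             ∎
    where open ≡-Reasoning

  shift-to-zero : ∀ {v} → v ≤ n → shift n (n ∸ v) v ≡ 0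
  shift-to-zero v≤n = trans (cong (_% n) (m+[n∸m]≡n v≤n)) (n%n≡0 n)

  rot-rot : ∀ j k π → rot n j (rot n k π) ≡ rot n (k + j) π
  rot-rot j k π = trans (sym (map-∘ π)) (map-cong (shift-shift j k) π)

  rot-% : ∀ k π → rot n (k % n) π ≡ rot n k π
  rot-% k = map-cong (shift-% k)

  rot-< : ∀ k π → All (_< n) (rot n k π)
  rot-< k π = All.map⁺ (All.universal (shift-< k) π)

  rot-inverse : ∀ {k π} → k ≤ n → All (_< n) π → rot n (n ∸ k) (rot n k π) ≡ π
  rot-inverse {π = π} k≤n π<n = trans (sym (map-∘ π)) (map-id-local (All.map (shift-inverse k≤n) π<n))

  rot-injective : ∀ {k π ρ} → k ≤ n → All (_< n) π → All (_< n) ρ → rot n k π ≡ rot n k ρ → π ≡ ρ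
  rot-injective {k} k≤n π<n ρ<n eq =
    trans (sym (rot-inverse k≤n π<n)) (trans (cong (rot n (n ∸ k)) eq) (rot-inverse k≤n ρ<n))

module _ (n′ : ℕ) where

  private
    n : ℕ
    n = suc n′

  -- upTo n reduces to 0 ∷ nonzeroLetters, which is used silently below.
  nonzeroLetters : List ℕ
  nonzeroLetters = applyUpTo suc n′

  upTo-< : All (_< n) (upTo n)
  upTo-< = All.tabulate ∈-upTo⁻

  length-nonzeroLetters : length nonzeroLetters ≡ n′
  length-nonzeroLetters = length-applyUpTo suc n′

  nonzeroLetters-< : All (_< n) nonzeroLetters
  nonzeroLetters-< = All.tail upTo-<

  perm-< : ∀ {π} → IsPerm n π → All (_< n) π
  perm-< π↭ = All-resp-↭ (↭-sym π↭) upTo-<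

  rot-1-upTo : rot n 1 (upTo n) ≡ nonzeroLetters ∷ʳ 0
  rot-1-upTo = begin
    rot n 1 (upTo n)                  ≡⟨ cong (rot n 1) (upTo-∷ʳ n′) ⟨
    rot n 1 (upTo n′ ∷ʳ n′)           ≡⟨ map-++ (shift n 1) (upTo n′) (n′ ∷ []) ⟩
    rot n 1 (upTo n′) ∷ʳ shift n 1 n′ ≡⟨ cong₂ _∷ʳ_ shift-below-n′ shift-n′ ⟩
    nonzeroLetters ∷ʳ 0               ∎
    where
    open ≡-Reasoning
    shift-below-n′ : rot n 1 (upTo n′) ≡ nonzeroLetters
    shift-below-n′ = trans (map-cong-local (All.tabulate (shift-1 ∘ ∈-upTo⁻))) (map-applyUpTo id suc n′)
      where
      shift-1 : ∀ {i} → i < n′ → shift n 1 i ≡ suc i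
      shift-1 {i} i<n′ = trans (cong (_% n) (+-comm i 1)) (m<n⇒m%n≡m (s≤s i<n′))
    shift-n′ : shift n 1 n′ ≡ 0
    shift-n′ = trans (cong (_% n) (+-comm n′ 1)) (n%n≡0 n)

  rot-upTo-↭ : ∀ k → rot n k (upTo n) ↭ upTo n
  rot-upTo-↭ zero    = ↭-reflexive (map-id-local (All.map shift-identity upTo-<))
  rot-upTo-↭ (suc k) = begin
    rot n (suc k) (upTo n)         ≡⟨ cong (λ j → rot n j (upTo n)) (+-comm 1 k) ⟩
    rot n (k + 1) (upTo n)         ≡⟨ rot-rot 1 k (upTo n) ⟨
    rot n 1 (rot n k (upTo n))     ↭⟨ map⁺ (shift n 1) (rot-upTo-↭ k) ⟩
    rot n 1 (upTo n)               ≡⟨ rot-1-upTo ⟩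
    nonzeroLetters ∷ʳ 0            ↭⟨ ∷↭∷ʳ 0 nonzeroLetters ⟨
    upTo n                         ∎
    where open PermutationReasoning

  rot-↭ : ∀ k {π} → IsPerm n π → IsPerm n (rot n k π)
  rot-↭ k π↭ = ↭-trans (map⁺ (shift n k) π↭) (rot-upTo-↭ k)

  rot-to-representative : ∀ {π} → IsPerm n π → ∃₂ λ k p → rot n k π ≡ 0 ∷ p × p ↭ nonzeroLetters
  rot-to-representative {[]}    π↭ = contradiction (↭-length π↭) λ ()
  rot-to-representative {v ∷ π} π↭ = n ∸ v , rot n (n ∸ v) π , rot≡ , drop-∷ (subst (_↭ upTo n) rot≡ (rot-↭ (n ∸ v) π↭))
    where
    rot≡ : rot n (n ∸ v) (v ∷ π) ≡ 0 ∷ rot n (n ∸ v) π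
    rot≡ = cong (_∷ rot n (n ∸ v) π) (shift-to-zero (<⇒≤ (All.head (perm-< π↭))))

  chain : ℕ → List (List ℕ) → List ℕ
  chain a []       = []
  chain a (p ∷ ps) = rot n a p ++ chain (lastOf a (rot n a p)) ps

  chain-< : ∀ a ps → All (_< n) (chain a ps)
  chain-< a []       = []
  chain-< a (p ∷ ps) = All.++⁺ (rot-< a p) (chain-< _ ps)

  length-chain : ∀ a ps → All (λ p → length p ≡ n′) ps → length (chain a ps) ≡ length ps * n′
  length-chain a []       []             = refl
  length-chain a (p ∷ ps) (len-p ∷ lens) =
    trans (length-++ (rot n a p)) (cong₂ _+_ (trans (length-map _ p) len-p) (length-chain _ ps lens))

  chain-factor : ∀ {a ps p} → a < n → p ∈ ps → ∃ λ k → k < n × Factor (rot n k (0 ∷ p)) (a ∷ chain a ps)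
  chain-factor {a} {p ∷ ps} a<n (here refl) =
    a , a<n , [] , chain b ps , cong (λ c → c ∷ rot n a p ++ chain b ps) (sym (shift-zero a<n))
    where b = lastOf a (rot n a p)
  chain-factor {a} {q ∷ ps} {p} a<n (there p∈)
    with init , a∷q≡ ← lastOf-split a (rot n a q)
    with k , k<n , xs , ys , eq ← chain-factor (All-lastOf (a<n ∷ rot-< a q)) p∈ =
    k , k<n , init ++ xs , ys , (begin
      a ∷ rot n a q ++ chain b ps ≡⟨ cong (_++ chain b ps) a∷q≡ ⟩
      (init ∷ʳ b) ++ chain b ps   ≡⟨ ++-assoc init (b ∷ []) (chain b ps) ⟩
      init ++ b ∷ chain b ps      ≡⟨ cong (init ++_) eq ⟩
      init ++ xs ++ w ++ ys       ≡⟨ ++-assoc init xs (w ++ ys) ⟨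
      (init ++ xs) ++ w ++ ys     ∎)
    where
    open ≡-Reasoning
    b = lastOf a (rot n a q)
    w = rot n k (0 ∷ p)

  universalWord : List ℕ
  universalWord = 0 ∷ chain 0 (permutations nonzeroLetters)

  universalWord-universal : Universal n universalWord
  universalWord-universal = (s≤s z≤n ∷ chain-< 0 (permutations nonzeroLetters)) , covers
    where
    covers : ∀ π → IsPerm n π → Σ ℕ λ k → k < n × Factor (rot n k π) universalWord
    covers π π↭
      with k , p , rot-π , p↭ ← rot-to-representative π↭
      with j , j<n , xs , ys , eq ← chain-factor (s≤s z≤n) (↭⇒∈-permutations nonzeroLetters p↭) =
      (k + j) % n , m%n<n (k + j) n , xs , ys , subst (λ w → universalWord ≡ xs ++ w ++ ys) rot≡ eq
      where
      open ≡-Reasoning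
      rot≡ : rot n j (0 ∷ p) ≡ rot n ((k + j) % n) π
      rot≡ = begin
        rot n j (0 ∷ p)         ≡⟨ cong (rot n j) rot-π ⟨
        rot n j (rot n k π)     ≡⟨ rot-rot j k π ⟩
        rot n (k + j) π         ≡⟨ rot-% (k + j) π ⟨
        rot n ((k + j) % n) π   ∎

  length-permutations-nonzeroLetters : length (permutations nonzeroLetters) ≡ n′ !
  length-permutations-nonzeroLetters = trans (length-permutations nonzeroLetters) (cong _! length-nonzeroLetters)

  length-universalWord : length universalWord ≡ S n
  length-universalWord = begin
    suc (length (chain 0 (permutations nonzeroLetters))) ≡⟨ cong suc (length-chain 0 _ (All.tabulate len)) ⟩
    suc (length (permutations nonzeroLetters) * n′)      ≡⟨ cong (λ m → suc (m * n′)) length-permutations-nonzeroLetters ⟩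
    suc (n′ ! * n′)                                      ≡⟨ cong suc (*-comm (n′ !) n′) ⟩
    suc (n′ * n′ !)                                      ≡⟨ +-comm 1 (n′ * n′ !) ⟩
    n′ * n′ ! + 1                                        ∎
    where
    open ≡-Reasoning
    len : ∀ {p} → p ∈ permutations nonzeroLetters → length p ≡ n′
    len p∈ = trans (↭-length (permutations-↭ nonzeroLetters p∈)) length-nonzeroLetters

  RotationAt : List ℕ → ℕ → List ℕ → Set
  RotationAt u i p = ∃ λ k → k < n × take n (drop i u) ≡ rot n k (0 ∷ p)

  rotationAt-unique : ∀ {u i p q} → All (_< n) p → All (_< n) q →
    RotationAt u i p → RotationAt u i q → p ≡ q
  rotationAt-unique p<n q<n (k , k<n , wp) (k′ , k′<n , wq)
    with refl ← trans (sym (shift-zero k<n)) (trans (∷-injectiveˡ (trans (sym wp) wq)) (shift-zero k′<n)) =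
    rot-injective (<⇒≤ k<n) p<n q<n (∷-injectiveʳ (trans (sym wp) wq))

  rotationAt-universal : ∀ {u p} → Universal n u → p ↭ nonzeroLetters →
    ∃ λ i → i + n ≤ length u × RotationAt u i p
  rotationAt-universal {p = p} (_ , covers) p↭
    with k , k<n , xs , ys , refl ← covers (0 ∷ p) (prep 0 p↭) =
    length xs , bound , k , k<n , subst (λ m → take m (drop (length xs) (xs ++ w ++ ys)) ≡ w) len-w (take-drop-++ xs w ys)
    where
    w = rot n k (0 ∷ p)
    len-w : length w ≡ n
    len-w = trans (length-map _ (0 ∷ p)) (cong suc (trans (↭-length p↭) length-nonzeroLetters))
    bound : length xs + n ≤ length (xs ++ w ++ ys)
    bound = begin
      length xs + n                          ≡⟨ cong (length xs +_) len-w ⟨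
      length xs + length w                   ≤⟨ +-monoʳ-≤ (length xs) (m≤m+n (length w) (length ys)) ⟩
      length xs + (length w + length ys)     ≡⟨ cong (length xs +_) (length-++ w) ⟨
      length xs + length (w ++ ys)           ≡⟨ length-++ xs ⟨
      length (xs ++ w ++ ys)                 ∎
      where open ≤-Reasoning

  universal⇒I≤length : ∀ {u} → Universal n u → I n ≤ length u
  universal⇒I≤length {u} U = m≤o∸n⇒m+n≤o (n′ !) n′≤L count
    where
    L = length u
    occ : ∀ {p} → p ∈ permutations nonzeroLetters → ∃ λ i → i + n ≤ L × RotationAt u i p
    occ p∈ = rotationAt-universal U (permutations-↭ nonzeroLetters p∈)
    before-end : ∀ {i} → i + n ≤ L → i < L ∸ n′
    before-end {i} i+n≤L = m+n≤o⇒m≤o∸n (suc i) (subst (_≤ L) (+-suc i n′) i+n≤L)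
    position : ∀ {p} → p ∈ permutations nonzeroLetters → Fin (L ∸ n′)
    position p∈ = fromℕ< (before-end (proj₁ (proj₂ (occ p∈))))
    position-injective : ∀ {p q} (p∈ : p ∈ permutations nonzeroLetters) (q∈ : q ∈ permutations nonzeroLetters) →
      position p∈ ≡ position q∈ → p ≡ q
    position-injective {p} {q} p∈ q∈ eq =
      rotationAt-unique {u} {proj₁ (occ q∈)} (letters p∈) (letters q∈)
        (subst (λ i → RotationAt u i p) (fromℕ<-injective _ _ _ _ eq) (proj₂ (proj₂ (occ p∈))))
        (proj₂ (proj₂ (occ q∈)))
      where
      letters : ∀ {r} → r ∈ permutations nonzeroLetters → All (_< n) r
      letters r∈ = All-resp-↭ (↭-sym (permutations-↭ nonzeroLetters r∈)) nonzeroLetters-<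
    count : n′ ! ≤ L ∸ n′
    count = subst (_≤ L ∸ n′) length-permutations-nonzeroLetters
      (unique-length-≤ (permutations-unique (Unique.drop⁺ 1 (Unique.upTo⁺ n))) position position-injective)
    n′≤L : n′ ≤ L
    n′≤L = ≤-trans (n≤1+n n′) (≤-trans (m≤n+m n _) (proj₁ (proj₂ (occ (↭⇒∈-permutations nonzeroLetters ↭-refl)))))

  universal? : ∀ u → Dec (Universal n u)
  universal? u = All.all? (_<? n) u ×-dec map′ fromAll toAll (All.all? covered? (permutations (upTo n)))
    where
    Covered : List ℕ → Set
    Covered π = Σ ℕ λ k → k < n × Factor (rot n k π) u
    covered? : ∀ π → Dec (Covered π)
    covered? π = anyUpTo? (λ k → factor? (rot n k π) u) n
    fromAll : All Covered (permutations (upTo n)) → ∀ π → IsPerm n π → Covered π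
    fromAll covered π π↭ = All.lookup covered (↭⇒∈-permutations (upTo n) π↭)
    toAll : (∀ π → IsPerm n π → Covered π) → All Covered (permutations (upTo n))
    toAll covers = All.tabulate (λ {π} π∈ → covers π (permutations-↭ (upTo n) π∈))

  universal-of-length? : ∀ ℓ → Dec (∃ λ u → Universal n u × length u ≡ ℓ)
  universal-of-length? ℓ = map′ (λ (u , _ , len , U) → u , U , len) (λ (u , U , len) → u , proj₁ U , len , U)
    (words? universal? n ℓ)

  minimal-universal-length : ∃ λ L → IsMinUniversalLength n L × I n ≤ L × L ≤ S n
  minimal-universal-length
    with L , (u , U , refl) , minimal ← least-satisfying universal-of-length? (universalWord , universalWord-universal , length-universalWord) =
    L , ((u , U , refl) , λ v V → minimal (v , V , refl)) , universal⇒I≤length U ,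
    minimal (universalWord , universalWord-universal , length-universalWord)

open +-*-Solver

m[1+m]≤2*m! : ∀ r → (3 + r) * (4 + r) ≤ 2 * (3 + r) !
m[1+m]≤2*m! zero    = ≤-refl
m[1+m]≤2*m! (suc r) = begin
  (4 + r) * (5 + r)             ≤⟨ *-monoʳ-≤ (4 + r) 5+r≤ ⟩
  (4 + r) * ((3 + r) * (4 + r)) ≤⟨ *-monoʳ-≤ (4 + r) (m[1+m]≤2*m! r) ⟩
  (4 + r) * (2 * (3 + r) !)     ≡⟨ solve 2 (λ r F → (con 4 :+ r) :* (con 2 :* F) := con 2 :* ((con 4 :+ r) :* F)) refl r ((3 + r) !) ⟩
  2 * (4 + r) !                 ∎
  where
  open ≤-Reasoning
  5+r≤ : 5 + r ≤ (3 + r) * (4 + r)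
  5+r≤ = subst (5 + r ≤_)
    (solve 1 (λ r → (con 5 :+ r) :+ (con 7 :+ con 6 :* r :+ r :* r) := (con 3 :+ r) :* (con 4 :+ r)) refl r)
    (m≤m+n (5 + r) (7 + 6 * r + r * r))

ratio-bound : ∀ k r → 3 * k ≤ r → k * ∣ S (4 + r) - (4 + r) * I (4 + r) ∣ < (4 + r) * I (4 + r)
ratio-bound k r 3k≤r = begin-strict
  k * ∣ S n - n * I n ∣     ≡⟨ cong (λ x → k * ∣ S n - x ∣) n*I≡S+gap ⟩
  k * ∣ S n - S n + gap ∣   ≡⟨ cong (k *_) (∣m-m+n∣≡n (S n) gap) ⟩
  k * gap                   ≤⟨ *-monoʳ-≤ k gap≤3*m! ⟩
  k * (3 * m !)             ≡⟨ solve 2 (λ k F → k :* (con 3 :* F) := (con 3 :* k) :* F) refl k (m !) ⟩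
  (3 * k) * m !             ≤⟨ *-monoˡ-≤ (m !) (≤-trans 3k≤r (m≤n+m r 3)) ⟩
  m * m !                   <⟨ m<m+n (m * m !) z<s ⟩
  S n                       ≤⟨ m≤m+n (S n) gap ⟩
  S n + gap                 ≡⟨ n*I≡S+gap ⟨
  n * I n                   ∎
  where
  open ≤-Reasoning
  n = 4 + r
  m = 3 + r
  gap = m ! + (m * m + (2 + r))
  n*I≡S+gap : n * I n ≡ S n + gap
  n*I≡S+gap = solve 2 (λ r F → (con 4 :+ r) :* (F :+ (con 3 :+ r)) :=
    ((con 3 :+ r) :* F :+ con 1) :+ (F :+ ((con 3 :+ r) :* (con 3 :+ r) :+ (con 2 :+ r)))) refl r (m !)
  gap≤3*m! : gap ≤ 3 * m !
  gap≤3*m! = begin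
    m ! + (m * m + (2 + r))   ≤⟨ +-monoʳ-≤ (m !) (≤-trans m*m+2+r≤ (m[1+m]≤2*m! r)) ⟩
    m ! + 2 * m !             ≡⟨ solve 1 (λ F → F :+ con 2 :* F := con 3 :* F) refl (m !) ⟩
    3 * m !                   ∎
    where
    m*m+2+r≤ : m * m + (2 + r) ≤ m * (4 + r)
    m*m+2+r≤ = subst (m * m + (2 + r) ≤_)
      (solve 1 (λ r → ((con 3 :+ r) :* (con 3 :+ r) :+ (con 2 :+ r)) :+ con 1 := (con 3 :+ r) :* (con 4 :+ r)) refl r)
      (m≤m+n (m * m + (2 + r)) 1)

ratio-asymptotic : RatioAsymptoticToN
ratio-asymptotic k _ = 4 + 3 * k , λ where
  n N≤n → subst (λ n → k * ∣ S n - n * I n ∣ < n * I n) (m+[n∸m]≡n N≤n)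
    (ratio-bound k (3 * k + (n ∸ (4 + 3 * k))) (m≤m+n (3 * k) _))

proposition7 : (∀ n' → Σ ℕ λ L → IsMinUniversalLength (suc n') L × I (suc n') ≤ L × L ≤ S (suc n'))
    × RatioAsymptoticToN
proposition7 = minimal-universal-length , ratio-asymptotic
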